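{- Let $s>7$ be a square-free integer with $7\nmid s$ and $s\equiv 1\pmod 4$, and let $K=\mathbb{Q}(\sqrt{7},\sqrt{s})$. Then $\mathcal{P}(\mathcal{O}_K)\geq 6$. In particular, the element $$\alpha = 1^2+1^2+1^2+(1+\sqrt{7})^2+\left(\frac{1+\sqrt{s}}{2}\right)^2+\left(1+\frac{1+\sqrt{s}}{2}\right)^2\in\mathcal{O}_K$$ has length $\ell(\alpha)=6$.
   Context: For a commutative ring $R$, the length $\ell(\alpha)$ of a sum of squares $\alpha$ is the minimal number of squares of elements of $R$ summing to $\alpha$, and the Pythagoras number $\mathcal{P}(R)$ is the supremum of lengths of all finite sums of squares in $R$. $\mathcal{O}_K$ is the ring of integers of $K$. -}

module Defs where

open import Data.Nat as ℕ using (ℕ; _/_)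
open import Data.Nat.Divisibility using (_∣_)
open import Data.Nat.Primality using (Prime)
open import Data.Integer as ℤ using (ℤ; +_)
open import Data.Vec using (Vec; []; _∷_)
open import Data.Product using (Σ; ∃; _×_)
open import Relation.Nullary using (¬_)
open import Relation.Binary.PropositionalEquality using (_≡_)

SquareFree : ℕ → Set
SquareFree n = ∀ p → Prime p → ¬ (p ℕ.* p ∣ n)

-- ℤ[√7]: elements a + b√7.
record Z7 : Set where
  constructor mk7
  field
    re im : ℤ

infixl 6 _+₇_
infixl 7 _*₇_

_+₇_ : Z7 → Z7 → Z7
mk7 a b +₇ mk7 c d = mk7 (a ℤ.+ c) (b ℤ.+ d)

_*₇_ : Z7 → Z7 → Z7
mk7 a b *₇ mk7 c d = mk7 (a ℤ.* c ℤ.+ + 7 ℤ.* (b ℤ.* d)) (a ℤ.* d ℤ.+ b ℤ.* c)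

scale₇ : ℤ → Z7 → Z7
scale₇ t (mk7 a b) = mk7 (t ℤ.* a) (t ℤ.* b)

0₇ 1₇ : Z7
0₇ = mk7 (+ 0) (+ 0)
1₇ = mk7 (+ 1) (+ 0)

-- For s ≡ 1 (mod 4) with gcd(s,7)=1 (s square-free), the ring of integers of
-- K = ℚ(√7, √s) is ℤ[√7][ω] with ω = (1 + √s)/2, i.e. it has ℤ-basis
-- 1, √7, ω, √7·ω.  Here ω² = ω + (s-1)/4, and (s-1)/4 = s / 4 (floor) when s ≡ 1 mod 4.
tₛ : ℕ → ℤ
tₛ s = + (s / 4)

-- An element A + C·ω of O_K, with A, C ∈ ℤ[√7].
record OK (s : ℕ) : Set where
  constructor mkOK
  field
    fst snd : Z7

module _ {s : ℕ} where
  infixl 6 _+ₖ_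
  infixl 7 _*ₖ_

  _+ₖ_ : OK s → OK s → OK s
  mkOK a c +ₖ mkOK b d = mkOK (a +₇ b) (c +₇ d)

  _*ₖ_ : OK s → OK s → OK s
  mkOK a c *ₖ mkOK b d =
    mkOK (a *₇ b +₇ scale₇ (tₛ s) (c *₇ d)) (a *₇ d +₇ c *₇ b +₇ c *₇ d)

  0ₖ 1ₖ √7 ω : OK s
  0ₖ = mkOK 0₇ 0₇
  1ₖ = mkOK 1₇ 0₇
  √7 = mkOK (mk7 (+ 0) (+ 1)) 0₇
  ω  = mkOK 0₇ 1₇

  sq : OK s → OK s
  sq x = x *ₖ x

  sumSq : ∀ {n} → Vec (OK s) n → OK s
  sumSq [] = 0ₖ
  sumSq (x ∷ xs) = sq x +ₖ sumSq xs

RepBy : (s : ℕ) → ℕ → OK s → Set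
RepBy s n α = Σ (Vec (OK s) n) λ v → sumSq v ≡ α

HasLength : (s : ℕ) → OK s → ℕ → Set
HasLength s α n = RepBy s n α × (∀ m → m ℕ.< n → ¬ RepBy s m α)

PythagorasAtLeast : (s : ℕ) → ℕ → Set
PythagorasAtLeast s n =
  Σ (OK s) λ β → (∃ λ k → RepBy s k β) × (∀ m → m ℕ.< n → ¬ RepBy s m β)

alpha : (s : ℕ) → OK s
alpha s = sq 1ₖ +ₖ sq 1ₖ +ₖ sq 1ₖ +ₖ sq (1ₖ +ₖ √7) +ₖ sq ω +ₖ sq (1ₖ +ₖ ω)

{-# OPTIONS --safe #-}
-- Write x ∈ O_K as (a + b√7) + (c + d√7)ω with ω² = ω + t, t = (s - 1)/4. The
-- coordinates of x₁² + ⋯ + xₙ² are linear in the Gram matrix of the coordinate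
-- vectors a, b, c, d ∈ ℤⁿ, and α = (12 + 2t) + 2√7 + 4ω. The rational coordinate
-- gives a·a + 7 b·b + t (c·c + 7 d·d) = 12 + 2t; since t ≥ 3 (s ≥ 13, as 9 is not
-- squarefree) this forces d = 0, after which the other coordinates pin the Gram
-- matrix of (a, b, c) down to [[5,1,1],[1,1,0],[1,0,2]]. Then b = ±eᵢ with
-- aᵢ = bᵢ and cᵢ = 0, and dropping coordinate i realises [[4,1],[1,2]] in ℤⁿ⁻¹,
-- which a finite search rules out for n - 1 ≤ 4. The six squares defining α
-- realise this Gram data with n = 6.

module Submission where

open import Defs
open import Data.Nat using (ℕ; _<_; _%_)
open import Data.Nat.Divisibility using (_∣_)
open import Data.Product using (_×_)
open import Relation.Nullary using (¬_)
open import Relation.Binary.PropositionalEquality using (_≡_)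

open import Data.Bool using (Bool; T; _∧_)
open import Data.Bool.ListAction using (any)
open import Data.Empty using (⊥; ⊥-elim)
open import Data.Integer as ℤ using (ℤ; +_; -[1+_]; _+_; _*_; _-_; ∣_∣; +≤+; _≟_)
import Data.Integer.Properties as ℤP
open import Data.Integer.Tactic.RingSolver using (solve-∀)
open import Data.List using (List; []; _∷_; _++_; length)
open import Data.List.Properties using (length-++-sucʳ)
open import Data.List.Membership.Propositional using (_∈_; lose)
open import Data.List.Relation.Unary.All using (All; []; _∷_)
open import Data.List.Relation.Unary.Any using (here; there)
open import Data.List.Relation.Unary.Any.Properties using (any⁺)
open import Data.Nat as ℕ using (zero; suc; _≤_; z≤n; s≤s; _/_; _<?_)
import Data.Nat.DivMod as ℕ
import Data.Nat.Properties as ℕP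
open import Data.Nat.Divisibility using (divides)
open import Data.Nat.Primality using (prime?)
open import Data.Nat.Tactic.RingSolver using () renaming (solve-∀ to solve-∀ℕ)
open import Data.Product using (∃; ∃₂; _,_)
open import Data.Sum using (_⊎_; inj₁; inj₂; [_,_]′)
open import Data.Vec using (Vec; []; _∷_; toList; foldl′)
open import Data.Vec.Properties using (length-toList)
open import Function using (_∘_; id)
open import Relation.Binary.PropositionalEquality
  using (_≢_; refl; sym; trans; cong; cong₂; subst; module ≡-Reasoning)
open import Relation.Nullary.Decidable using (⌊_⌋; from-yes; from-no)
open import Relation.Nullary.Negation using (contradiction)

open import Algebra.Properties.AbelianGroup ℤP.+-0-abelianGroup
  using () renaming (∙-cancelˡ to +-cancelˡ; ∙-cancelʳ to +-cancelʳ)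
open import Algebra.Properties.CommutativeSemigroup ℤP.+-commutativeSemigroup
  using () renaming (x∙yz≈y∙xz to +-swap)

open ≡-Reasoning

0≤i*i : ∀ i → + 0 ℤ.≤ i * i
0≤i*i (+ zero)  = +≤+ z≤n
0≤i*i (+ suc _) = +≤+ z≤n
0≤i*i -[1+ _ ]  = +≤+ z≤n

i*i≡0⇒i≡0 : ∀ i → i * i ≡ + 0 → i ≡ + 0
i*i≡0⇒i≡0 i i*i≡0 = [ id , id ]′ (ℤP.i*j≡0⇒i≡0∨j≡0 i i*i≡0)

∣i∣≤∣i*i+j∣ : ∀ i {j} → + 0 ℤ.≤ j → ∣ i ∣ ≤ ∣ i * i + j ∣
∣i∣≤∣i*i+j∣ (+ zero)  _               = z≤n
∣i∣≤∣i*i+j∣ (+ suc n) (+≤+ {n = j} _) = s≤s (ℕP.≤-trans (ℕP.m≤m+n n (n ℕ.* suc n)) (ℕP.m≤m+n _ j))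
∣i∣≤∣i*i+j∣ -[1+ n ]  (+≤+ {n = j} _) = s≤s (ℕP.≤-trans (ℕP.m≤m+n n (n ℕ.* suc n)) (ℕP.m≤m+n _ j))

i+j≡0⇒i≡0∧j≡0 : ∀ {i j} → + 0 ℤ.≤ i → + 0 ℤ.≤ j → i + j ≡ + 0 → i ≡ + 0 × j ≡ + 0
i+j≡0⇒i≡0∧j≡0 (+≤+ {n = zero} _) (+≤+ {n = zero} _) _ = refl , refl

i+j≡1⇒i≡0∧j≡1∨i≡1∧j≡0 : ∀ {i j} → + 0 ℤ.≤ i → + 0 ℤ.≤ j → i + j ≡ + 1 →
                          (i ≡ + 0 × j ≡ + 1) ⊎ (i ≡ + 1 × j ≡ + 0)
i+j≡1⇒i≡0∧j≡1∨i≡1∧j≡0 (+≤+ {n = zero} _)     (+≤+ _)            j≡1 = inj₁ (refl , j≡1)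
i+j≡1⇒i≡0∧j≡1∨i≡1∧j≡0 (+≤+ {n = suc zero} _) (+≤+ {n = zero} _) _   = inj₂ (refl , refl)

x≡x*b*b : ∀ {b} → b * b ≡ + 1 → ∀ x → x ≡ x * b * b
x≡x*b*b {b} b*b≡1 x = begin
  x           ≡⟨ ℤP.*-identityʳ x ⟨
  x * + 1     ≡⟨ cong (x *_) b*b≡1 ⟨
  x * (b * b) ≡⟨ ℤP.*-assoc x b b ⟨
  x * b * b   ∎

[i+j]-i≡j : ∀ i j → i + j - i ≡ j
[i+j]-i≡j = solve-∀

i+j≡i : ∀ i {j} → j ≡ + 0 → i + j ≡ i
i+j≡i i refl = ℤP.+-identityʳ i

i*j≡0 : ∀ i {j} → j ≡ + 0 → i * j ≡ + 0
i*j≡0 i refl = ℤP.*-zeroʳ i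

2i+j≡4⇒j≡2[2-i] : ∀ i j → + 2 * i + j ≡ + 4 → j ≡ + 2 * (+ 2 - i)
2i+j≡4⇒j≡2[2-i] i j 2i+j≡4 = begin
  j                     ≡⟨ [i+j]-i≡j (+ 2 * i) j ⟨
  + 2 * i + j - + 2 * i ≡⟨ cong (_- + 2 * i) 2i+j≡4 ⟩
  + 4 - + 2 * i         ≡⟨ 4-2i≡2[2-i] i ⟩
  + 2 * (+ 2 - i)       ∎
  where
  4-2i≡2[2-i] : ∀ i → + 4 - + 2 * i ≡ + 2 * (+ 2 - i)
  4-2i≡2[2-i] = solve-∀

-- Integer vectors indexed by a list

module _ {X : Set} where

  ⟪_,_⟫ : (X → ℤ) → (X → ℤ) → List X → ℤ
  ⟪ f , g ⟫ []      = + 0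
  ⟪ f , g ⟫ (x ∷ L) = f x * g x + ⟪ f , g ⟫ L

  ⟪⟫-comm : ∀ f g L → ⟪ f , g ⟫ L ≡ ⟪ g , f ⟫ L
  ⟪⟫-comm f g []      = refl
  ⟪⟫-comm f g (x ∷ L) = cong₂ _+_ (ℤP.*-comm (f x) (g x)) (⟪⟫-comm f g L)

  0≤⟪f,f⟫ : ∀ f L → + 0 ℤ.≤ ⟪ f , f ⟫ L
  0≤⟪f,f⟫ f []      = +≤+ z≤n
  0≤⟪f,f⟫ f (x ∷ L) = ℤP.+-mono-≤ (0≤i*i (f x)) (0≤⟪f,f⟫ f L)

  ∣⟪f,f⟫∣≡n⇒⟪f,f⟫≡n : ∀ f L {n} → ∣ ⟪ f , f ⟫ L ∣ ≡ n → ⟪ f , f ⟫ L ≡ + n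
  ∣⟪f,f⟫∣≡n⇒⟪f,f⟫≡n f L ∣⟪f,f⟫∣≡n =
    trans (sym (ℤP.0≤i⇒+∣i∣≡i (0≤⟪f,f⟫ f L))) (cong +_ ∣⟪f,f⟫∣≡n)

  g≡0⇒⟪f,g⟫≡0 : ∀ f {g L} → All (λ x → g x ≡ + 0) L → ⟪ f , g ⟫ L ≡ + 0
  g≡0⇒⟪f,g⟫≡0 f []             = refl
  g≡0⇒⟪f,g⟫≡0 f {L = x ∷ _} (gx≡0 ∷ g≡0) = cong₂ _+_ (i*j≡0 (f x) gx≡0) (g≡0⇒⟪f,g⟫≡0 f g≡0)

  ⟪f,f⟫≡0⇒f≡0 : ∀ f L → ⟪ f , f ⟫ L ≡ + 0 → All (λ x → f x ≡ + 0) L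
  ⟪f,f⟫≡0⇒f≡0 f []      _     = []
  ⟪f,f⟫≡0⇒f≡0 f (x ∷ L) ⟪f,f⟫≡0
    with i+j≡0⇒i≡0∧j≡0 (0≤i*i (f x)) (0≤⟪f,f⟫ f L) ⟪f,f⟫≡0
  ... | fx²≡0 , rest≡0 = i*i≡0⇒i≡0 (f x) fx²≡0 ∷ ⟪f,f⟫≡0⇒f≡0 f L rest≡0

  ⟪f,f⟫≡1⇒unit : ∀ f L → ⟪ f , f ⟫ L ≡ + 1 →
    ∃₂ λ L₁ L₂ → ∃ λ x → L ≡ L₁ ++ x ∷ L₂ × f x * f x ≡ + 1 × All (λ y → f y ≡ + 0) (L₁ ++ L₂)
  ⟪f,f⟫≡1⇒unit f (x ∷ L) ⟪f,f⟫≡1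
    with i+j≡1⇒i≡0∧j≡1∨i≡1∧j≡0 (0≤i*i (f x)) (0≤⟪f,f⟫ f L) ⟪f,f⟫≡1
  ... | inj₂ (fx²≡1 , rest≡0) = [] , L , x , refl , fx²≡1 , ⟪f,f⟫≡0⇒f≡0 f L rest≡0
  ... | inj₁ (fx²≡0 , rest≡1) with ⟪f,f⟫≡1⇒unit f L rest≡1
  ...   | L₁ , L₂ , y , refl , fy²≡1 , f≡0 =
    x ∷ L₁ , L₂ , y , refl , fy²≡1 , i*i≡0⇒i≡0 (f x) fx²≡0 ∷ f≡0

  ⟪⟫-++-∷ : ∀ f g L₁ x L₂ → ⟪ f , g ⟫ (L₁ ++ x ∷ L₂) ≡ f x * g x + ⟪ f , g ⟫ (L₁ ++ L₂)
  ⟪⟫-++-∷ f g []       x L₂ = refl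
  ⟪⟫-++-∷ f g (y ∷ L₁) x L₂ =
    trans (cong (_+_ (f y * g y)) (⟪⟫-++-∷ f g L₁ x L₂)) (+-swap (f y * g y) (f x * g x) _)

  ⟪⟫-pivot : ∀ f {g} L₁ x L₂ → All (λ y → g y ≡ + 0) (L₁ ++ L₂) →
             ⟪ f , g ⟫ (L₁ ++ x ∷ L₂) ≡ f x * g x
  ⟪⟫-pivot f L₁ x L₂ g≡0 =
    trans (⟪⟫-++-∷ f _ L₁ x L₂) (i+j≡i _ (g≡0⇒⟪f,g⟫≡0 f g≡0))

  ⟪⟫-remove : ∀ f g L₁ x L₂ {i j} → f x * g x ≡ i →
              ⟪ f , g ⟫ (L₁ ++ x ∷ L₂) ≡ i + j → ⟪ f , g ⟫ (L₁ ++ L₂) ≡ j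
  ⟪⟫-remove f g L₁ x L₂ refl ⟪f,g⟫≡i+j =
    +-cancelˡ (f x * g x) _ _ (trans (sym (⟪⟫-++-∷ f g L₁ x L₂)) ⟪f,g⟫≡i+j)

-- Realising Gram matrices in ℤⁿ

-- Every x with x * x ≤ A lies in window A; there is none when A < 0.
window : ℤ → List ℤ
window (+ zero)  = + 0 ∷ []
window (+ suc n) = + suc n ∷ -[1+ n ] ∷ window (+ n)
window -[1+ _ ]  = []

∣i∣≤n⇒i∈window : ∀ {i} n → ∣ i ∣ ≤ n → i ∈ window (+ n)
∣i∣≤n⇒i∈window {+ zero}   zero    _ = here refl
∣i∣≤n⇒i∈window {i}        (suc n) ∣i∣≤1+n with ℕP.m≤n⇒m<n∨m≡n ∣i∣≤1+n
... | inj₁ ∣i∣<1+n = there (there (∣i∣≤n⇒i∈window n (ℕP.≤-pred ∣i∣<1+n)))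
∣i∣≤n⇒i∈window {+ suc _}  (suc n) _ | inj₂ refl = here refl
∣i∣≤n⇒i∈window { -[1+ _ ]} (suc n) _ | inj₂ refl = there (here refl)

i∈window[i*i+j] : ∀ i {j} → + 0 ℤ.≤ j → i ∈ window (i * i + j)
i∈window[i*i+j] i {j} 0≤j = subst (λ A → i ∈ window A) (ℤP.0≤i⇒+∣i∣≡i 0≤A)
  (∣i∣≤n⇒i∈window _ (∣i∣≤∣i*i+j∣ i 0≤j))
  where
  0≤A : + 0 ℤ.≤ i * i + j
  0≤A = ℤP.+-mono-≤ (0≤i*i i) 0≤j

-- realisable? n A Q C: are there x, z ∈ ℤⁿ with x·x = A, x·z = Q, z·z = C?
realisable? : ℕ → ℤ → ℤ → ℤ → Bool
realisable? zero    A Q C = ⌊ A ≟ + 0 ⌋ ∧ ⌊ Q ≟ + 0 ⌋ ∧ ⌊ C ≟ + 0 ⌋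
realisable? (suc n) A Q C =
  any (λ x → any (λ z → realisable? n (A - x * x) (Q - x * z) (C - z * z)) (window C)) (window A)

realisable?-cong : ∀ {n A Q C A′ Q′ C′} → A ≡ A′ → Q ≡ Q′ → C ≡ C′ →
                   T (realisable? n A Q C) → T (realisable? n A′ Q′ C′)
realisable?-cong refl refl refl r = r

realisable?-step : ∀ {n A Q C} x z → + 0 ℤ.≤ A → + 0 ℤ.≤ C → T (realisable? n A Q C) →
                   T (realisable? (suc n) (x * x + A) (x * z + Q) (z * z + C))
realisable?-step {n} {A} {Q} {C} x z 0≤A 0≤C r =
  any⁺ _ (lose (i∈window[i*i+j] x 0≤A) (any⁺ _ (lose (i∈window[i*i+j] z 0≤C)
    (realisable?-cong {n} (sym ([i+j]-i≡j (x * x) A)) (sym ([i+j]-i≡j (x * z) Q))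
                          (sym ([i+j]-i≡j (z * z) C)) r))))

module _ {X : Set} (a c : X → ℤ) where

  realisable?-complete : ∀ n L → length L ≤ n →
                         T (realisable? n (⟪ a , a ⟫ L) (⟪ a , c ⟫ L) (⟪ c , c ⟫ L))
  realisable?-complete zero    []      _         = _
  realisable?-complete (suc n) []      _         =
    realisable?-step {n} {+ 0} {+ 0} {+ 0} (+ 0) (+ 0) (+≤+ z≤n) (+≤+ z≤n)
      (realisable?-complete n [] z≤n)
  realisable?-complete (suc n) (y ∷ L) (s≤s len) =
    realisable?-step {n} {⟪ a , a ⟫ L} {⟪ a , c ⟫ L} {⟪ c , c ⟫ L} (a y) (c y)
      (0≤⟪f,f⟫ a L) (0≤⟪f,f⟫ c L) (realisable?-complete n L len)

  ¬gram[[4,1],[1,2]]-in-ℤ⁴ : ∀ L → length L ≤ 4 →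
    ⟪ a , a ⟫ L ≡ + 4 → ⟪ a , c ⟫ L ≡ + 1 → ⟪ c , c ⟫ L ≡ + 2 → ⊥
  -- realisable? 4 (+ 4) (+ 1) (+ 2) evaluates to false, so its T is ⊥.
  ¬gram[[4,1],[1,2]]-in-ℤ⁴ L len aa ac cc =
    realisable?-cong {4} aa ac cc (realisable?-complete 4 L len)

module _ {X : Set} (a b c : X → ℤ) where

  -- b is a signed unit vector e, orthogonal to c and with a·e = 1; projecting it
  -- away leaves the Gram matrix [[4,1],[1,2]] in one dimension less.
  ¬gram[[5,1,1],[1,1,0],[1,0,2]]-in-ℤ⁵ : ∀ L → length L ≤ 5 →
    ⟪ a , a ⟫ L ≡ + 5 → ⟪ b , b ⟫ L ≡ + 1 → ⟪ c , c ⟫ L ≡ + 2 →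
    ⟪ a , b ⟫ L ≡ + 1 → ⟪ a , c ⟫ L ≡ + 1 → ⟪ b , c ⟫ L ≡ + 0 → ⊥
  ¬gram[[5,1,1],[1,1,0],[1,0,2]]-in-ℤ⁵ L len aa bb cc ab ac bc with ⟪f,f⟫≡1⇒unit b L bb
  ... | L₁ , L₂ , x , refl , bx²≡1 , b≡0 =
    ¬gram[[4,1],[1,2]]-in-ℤ⁴ a c (L₁ ++ L₂) len′
      (⟪⟫-remove a a L₁ x L₂ (trans (cong (λ z → z * z) ax≡bx) bx²≡1) aa)
      (⟪⟫-remove a c L₁ x L₂ (i*j≡0 (a x) cx≡0) ac)
      (⟪⟫-remove c c L₁ x L₂ (i*j≡0 (c x) cx≡0) cc)
    where
    len′ : length (L₁ ++ L₂) ≤ 4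
    len′ = ℕP.≤-pred (subst (_≤ 5) (length-++-sucʳ L₁ x L₂) len)
    ax≡bx : a x ≡ b x
    ax≡bx = begin
      a x             ≡⟨ x≡x*b*b bx²≡1 (a x) ⟩
      a x * b x * b x ≡⟨ cong (_* b x) (trans (sym (⟪⟫-pivot a L₁ x L₂ b≡0)) ab) ⟩
      + 1 * b x       ≡⟨ ℤP.*-identityˡ (b x) ⟩
      b x             ∎
    cx≡0 : c x ≡ + 0
    cx≡0 = begin
      c x             ≡⟨ x≡x*b*b bx²≡1 (c x) ⟩
      c x * b x * b x ≡⟨ cong (_* b x) (trans (sym (⟪⟫-pivot c L₁ x L₂ b≡0))
                                               (trans (⟪⟫-comm c b (L₁ ++ x ∷ L₂)) bc)) ⟩
      + 0 * b x       ≡⟨ ℤP.*-zeroˡ (b x) ⟩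
      + 0             ∎

-- The rational coordinate of α

-- 7t > 12 + 2t as soon as t ≥ 3.
norm-√7ω≡0 : ∀ {t A B C D} → 3 ≤ t →
             A ℕ.+ 7 ℕ.* B ℕ.+ t ℕ.* (C ℕ.+ 7 ℕ.* D) ≡ 12 ℕ.+ 2 ℕ.* t → D ≡ 0
norm-√7ω≡0 {D = zero} _ _ = refl
norm-√7ω≡0 {A = A} {B} {C} {suc D} (s≤s (s≤s (s≤s {n = u} _))) eq =
  ⊥-elim (ℕP.m+1+n≢m _ (trans (sym (excess u A B C D)) eq))
  where
  excess : ∀ u A B C D →
    A ℕ.+ 7 ℕ.* B ℕ.+ (3 ℕ.+ u) ℕ.* (C ℕ.+ 7 ℕ.* suc D)
      ≡ 12 ℕ.+ 2 ℕ.* (3 ℕ.+ u)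
        ℕ.+ suc (2 ℕ.+ 5 ℕ.* u ℕ.+ A ℕ.+ 7 ℕ.* B ℕ.+ (3 ℕ.+ u) ℕ.* C ℕ.+ 7 ℕ.* (3 ℕ.+ u) ℕ.* D)
  excess = solve-∀ℕ

norm-diagonal : ∀ {t A B C D m} → 3 ≤ t →
                A ℕ.+ 7 ℕ.* B ℕ.+ t ℕ.* (C ℕ.+ 7 ℕ.* D) ≡ 12 ℕ.+ 2 ℕ.* t →
                D ≡ 0 → C ≡ 2 ℕ.* m → B ≢ 0 → m ≢ 0 → A ≡ 5 × B ≡ 1 × C ≡ 2
norm-diagonal {B = zero} _ _ _ _ B≢0 _   = ⊥-elim (B≢0 refl)
norm-diagonal {m = zero} _ _ _ _ _ m≢0   = ⊥-elim (m≢0 refl)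
norm-diagonal {A = A} {suc b} {m = suc (suc m)} (s≤s (s≤s (s≤s {n = u} _))) eq refl refl _ _ =
  ⊥-elim (ℕP.m+1+n≢m _ (trans (sym (excess u A b m)) eq))
  where
  excess : ∀ u A b m →
    A ℕ.+ 7 ℕ.* suc b ℕ.+ (3 ℕ.+ u) ℕ.* (2 ℕ.* suc (suc m) ℕ.+ 7 ℕ.* 0)
      ≡ 12 ℕ.+ 2 ℕ.* (3 ℕ.+ u) ℕ.+ suc (A ℕ.+ 7 ℕ.* b ℕ.+ 2 ℕ.* u ℕ.+ 2 ℕ.* (3 ℕ.+ u) ℕ.* m)
  excess = solve-∀ℕ
norm-diagonal {t} {A} {1} {m = 1} _ eq refl refl _ _ =
  ℕP.+-cancelʳ-≡ (7 ℕ.+ t ℕ.* 2) A 5 (trans (sym (ℕP.+-assoc A 7 (t ℕ.* 2))) (trans eq (twelve t)))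
    , refl , refl
  where
  twelve : ∀ t → 12 ℕ.+ 2 ℕ.* t ≡ 5 ℕ.+ (7 ℕ.+ t ℕ.* 2)
  twelve = solve-∀ℕ
norm-diagonal {t} {A} {suc (suc b)} {m = 1} _ eq refl refl _ _ =
  ⊥-elim (ℕP.m+1+n≢m _ (trans (sym (excess t A b)) eq))
  where
  excess : ∀ t A b →
    A ℕ.+ 7 ℕ.* suc (suc b) ℕ.+ t ℕ.* 2 ≡ 12 ℕ.+ 2 ℕ.* t ℕ.+ suc (1 ℕ.+ A ℕ.+ 7 ℕ.* b)
  excess = solve-∀ℕ

norm-equation-in-ℕ : ∀ {t} {A B C D : ℤ} → + 0 ℤ.≤ A → + 0 ℤ.≤ B → + 0 ℤ.≤ C → + 0 ℤ.≤ D →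
  A + + 7 * B + + t * (C + + 7 * D) ≡ + 12 + + 2 * + t →
  ∣ A ∣ ℕ.+ 7 ℕ.* ∣ B ∣ ℕ.+ t ℕ.* (∣ C ∣ ℕ.+ 7 ℕ.* ∣ D ∣) ≡ 12 ℕ.+ 2 ℕ.* t
norm-equation-in-ℕ {t} (+≤+ {n = A} _) (+≤+ {n = B} _) (+≤+ {n = C} _) (+≤+ {n = D} _) eq =
  ℤP.+-injective (begin
    + (A ℕ.+ 7 ℕ.* B ℕ.+ t ℕ.* (C ℕ.+ 7 ℕ.* D))
      ≡⟨ cong₂ (λ p q → + A + p + q) (ℤP.pos-* 7 B)
               (trans (ℤP.pos-* t _) (cong (λ p → + t * (+ C + p)) (ℤP.pos-* 7 D))) ⟩
    + A + + 7 * + B + + t * (+ C + + 7 * + D)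
      ≡⟨ eq ⟩
    + 12 + + 2 * + t
      ≡⟨ cong (_+_ (+ 12)) (ℤP.pos-* 2 t) ⟨
    + (12 ℕ.+ 2 ℕ.* t) ∎)

-- Sums of squares in O_K

+₇-assoc : (x y z : Z7) → (x +₇ y) +₇ z ≡ x +₇ (y +₇ z)
+₇-assoc (mk7 a b) (mk7 c d) (mk7 e f) = cong₂ mk7 (ℤP.+-assoc a c e) (ℤP.+-assoc b d f)

+₇-identityʳ : (x : Z7) → x +₇ 0₇ ≡ x
+₇-identityʳ (mk7 a b) = cong₂ mk7 (ℤP.+-identityʳ a) (ℤP.+-identityʳ b)

αExpanded : (s : ℕ) → OK s
αExpanded s = mkOK (mk7 (+ 12 + + 2 * tₛ s) (+ 2)) (mk7 (+ 4) (+ 0))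

module _ {s : ℕ} where

  +ₖ-assoc : (x y z : OK s) → (x +ₖ y) +ₖ z ≡ x +ₖ (y +ₖ z)
  +ₖ-assoc (mkOK a c) (mkOK a′ c′) (mkOK a″ c″) = cong₂ mkOK (+₇-assoc a a′ a″) (+₇-assoc c c′ c″)

  +ₖ-identityʳ : (x : OK s) → x +ₖ 0ₖ ≡ x
  +ₖ-identityʳ (mkOK a c) = cong₂ mkOK (+₇-identityʳ a) (+₇-identityʳ c)

  acc+sumSq≡foldl : ∀ {n} acc (v : Vec (OK s) n) →
                    acc +ₖ sumSq v ≡ foldl′ (λ acc′ x → acc′ +ₖ sq x) acc v
  acc+sumSq≡foldl acc []      = +ₖ-identityʳ acc
  acc+sumSq≡foldl acc (x ∷ v) =
    trans (sym (+ₖ-assoc acc (sq x) (sumSq v))) (acc+sumSq≡foldl (acc +ₖ sq x) v)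

  sixSquares : Vec (OK s) 6
  sixSquares = 1ₖ ∷ 1ₖ ∷ 1ₖ ∷ (1ₖ +ₖ √7) ∷ ω ∷ (1ₖ +ₖ ω) ∷ []

  sumSq-sixSquares : sumSq sixSquares ≡ alpha s
  sumSq-sixSquares = acc+sumSq≡foldl (sq 1ₖ) (1ₖ ∷ 1ₖ ∷ (1ₖ +ₖ √7) ∷ ω ∷ (1ₖ +ₖ ω) ∷ [])

  c₁ c√7 cω c√7ω : OK s → ℤ
  c₁   = Z7.re ∘ OK.fst
  c√7  = Z7.im ∘ OK.fst
  cω   = Z7.re ∘ OK.snd
  c√7ω = Z7.im ∘ OK.snd

  gramForm : List (OK s) → OK s
  gramForm L = mkOK
    (mk7 (⟪ c₁ , c₁ ⟫ L + + 7 * ⟪ c√7 , c√7 ⟫ L + t * (⟪ cω , cω ⟫ L + + 7 * ⟪ c√7ω , c√7ω ⟫ L))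
         (+ 2 * (⟪ c₁ , c√7 ⟫ L + t * ⟪ cω , c√7ω ⟫ L)))
    (mk7 (+ 2 * (⟪ c₁ , cω ⟫ L + + 7 * ⟪ c√7 , c√7ω ⟫ L) + (⟪ cω , cω ⟫ L + + 7 * ⟪ c√7ω , c√7ω ⟫ L))
         (+ 2 * (⟪ c√7 , cω ⟫ L + ⟪ c₁ , c√7ω ⟫ L + ⟪ cω , c√7ω ⟫ L)))
    where t = tₛ s

  sq+gramForm≡gramForm-∷ : ∀ x L → sq x +ₖ gramForm L ≡ gramForm (x ∷ L)
  sq+gramForm≡gramForm-∷ (mkOK (mk7 a b) (mk7 c d)) L =
    cong₂ mkOK (cong₂ mk7 (fst-re (tₛ s) a b c d _ _ _ _) (fst-im (tₛ s) a b c d _ _))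
               (cong₂ mk7 (snd-re a b c d _ _ _ _) (snd-im a b c d _ _ _))
    where
    fst-re : ∀ t a b c d aa bb cc dd →
      a * a + + 7 * (b * b) + t * (c * c + + 7 * (d * d)) + (aa + + 7 * bb + t * (cc + + 7 * dd))
        ≡ (a * a + aa) + + 7 * (b * b + bb) + t * ((c * c + cc) + + 7 * (d * d + dd))
    fst-re = solve-∀
    fst-im : ∀ t a b c d ab cd →
      a * b + b * a + t * (c * d + d * c) + + 2 * (ab + t * cd)
        ≡ + 2 * ((a * b + ab) + t * (c * d + cd))
    fst-im = solve-∀
    snd-re : ∀ a b c d ac bd cc dd →
      a * c + + 7 * (b * d) + (c * a + + 7 * (d * b)) + (c * c + + 7 * (d * d))
        + (+ 2 * (ac + + 7 * bd) + (cc + + 7 * dd))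
        ≡ + 2 * ((a * c + ac) + + 7 * (b * d + bd)) + ((c * c + cc) + + 7 * (d * d + dd))
    snd-re = solve-∀
    snd-im : ∀ a b c d bc ad cd →
      a * d + b * c + (c * b + d * a) + (c * d + d * c) + + 2 * (bc + ad + cd)
        ≡ + 2 * ((b * c + bc) + (a * d + ad) + (c * d + cd))
    snd-im = solve-∀

  sumSq≡gramForm : ∀ {n} (v : Vec (OK s) n) → sumSq v ≡ gramForm (toList v)
  sumSq≡gramForm []      =
    cong₂ (λ p q → mkOK (mk7 p q) 0₇) (sym 0+t*0≡0) (sym (cong (_*_ (+ 2)) 0+t*0≡0))
    where
    0+t*0≡0 : + 0 + tₛ s * + 0 ≡ + 0
    0+t*0≡0 = trans (ℤP.+-identityˡ _) (ℤP.*-zeroʳ (tₛ s))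
  sumSq≡gramForm (x ∷ v) =
    trans (cong (sq x +ₖ_) (sumSq≡gramForm v)) (sq+gramForm≡gramForm-∷ x (toList v))

  -- The coordinate vectors of the six squares have Gram entries
  -- ⟪c₁,c₁⟫ = 5, ⟪c√7,c√7⟫ = 1, ⟪cω,cω⟫ = 2, ⟪c₁,c√7⟫ = ⟪c₁,cω⟫ = 1 and all others 0,
  -- so their gramForm evaluates up to the terms in t.
  alpha≡αExpanded : alpha s ≡ αExpanded s
  alpha≡αExpanded = begin
    alpha s                      ≡⟨ sumSq-sixSquares ⟨
    sumSq sixSquares             ≡⟨ sumSq≡gramForm sixSquares ⟩
    gramForm (toList sixSquares) ≡⟨ cong₂ (λ p q → mkOK (mk7 p q) (mk7 (+ 4) (+ 0)))
                                          (cong (_+_ (+ 12)) (ℤP.*-comm (tₛ s) (+ 2)))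
                                          (cong (λ p → + 2 * (+ 1 + p)) (ℤP.*-zeroʳ (tₛ s))) ⟩
    αExpanded s                  ∎

module _ {s : ℕ} (3≤t : 3 ≤ s / 4) (L : List (OK s)) (gram≡α : gramForm L ≡ αExpanded s) where

  private
    t : ℤ
    t = tₛ s

    A B C D : ℕ
    A = ∣ ⟪ c₁ , c₁ ⟫ L ∣
    B = ∣ ⟪ c√7 , c√7 ⟫ L ∣
    C = ∣ ⟪ cω , cω ⟫ L ∣
    D = ∣ ⟪ c√7ω , c√7ω ⟫ L ∣

    norm-equation : A ℕ.+ 7 ℕ.* B ℕ.+ s / 4 ℕ.* (C ℕ.+ 7 ℕ.* D) ≡ 12 ℕ.+ 2 ℕ.* (s / 4)
    norm-equation = norm-equation-in-ℕ {s / 4}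
      (0≤⟪f,f⟫ c₁ L) (0≤⟪f,f⟫ c√7 L) (0≤⟪f,f⟫ cω L) (0≤⟪f,f⟫ c√7ω L) (cong c₁ gram≡α)

    D≡0 : D ≡ 0
    D≡0 = norm-√7ω≡0 {s / 4} {A} {B} {C} {D} 3≤t norm-equation

    ⟪-,√7ω⟫≡0 : ∀ f → ⟪ f , c√7ω ⟫ L ≡ + 0
    ⟪-,√7ω⟫≡0 f = g≡0⇒⟪f,g⟫≡0 f (⟪f,f⟫≡0⇒f≡0 c√7ω L (ℤP.∣i∣≡0⇒i≡0 D≡0))

    ⟪1,√7⟫≡1 : ⟪ c₁ , c√7 ⟫ L ≡ + 1
    ⟪1,√7⟫≡1 = ℤP.*-cancelˡ-≡ (+ 2) _ (+ 1) (begin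
      + 2 * ⟪ c₁ , c√7 ⟫ L
        ≡⟨ cong (_*_ (+ 2)) (i+j≡i (⟪ c₁ , c√7 ⟫ L) (i*j≡0 t (⟪-,√7ω⟫≡0 cω))) ⟨
      + 2 * (⟪ c₁ , c√7 ⟫ L + t * ⟪ cω , c√7ω ⟫ L)
        ≡⟨ cong c√7 gram≡α ⟩
      + 2 ∎)

    ⟪√7,ω⟫≡0 : ⟪ c√7 , cω ⟫ L ≡ + 0
    ⟪√7,ω⟫≡0 = ℤP.*-cancelˡ-≡ (+ 2) _ (+ 0) (begin
      + 2 * ⟪ c√7 , cω ⟫ L
        ≡⟨ cong (_*_ (+ 2)) (trans (i+j≡i (⟪ c√7 , cω ⟫ L + ⟪ c₁ , c√7ω ⟫ L) (⟪-,√7ω⟫≡0 cω))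
                                   (i+j≡i (⟪ c√7 , cω ⟫ L) (⟪-,√7ω⟫≡0 c₁))) ⟨
      + 2 * (⟪ c√7 , cω ⟫ L + ⟪ c₁ , c√7ω ⟫ L + ⟪ cω , c√7ω ⟫ L)
        ≡⟨ cong c√7ω gram≡α ⟩
      + 0 ∎)

    2⟪1,ω⟫+⟪ω,ω⟫≡4 : + 2 * ⟪ c₁ , cω ⟫ L + ⟪ cω , cω ⟫ L ≡ + 4
    2⟪1,ω⟫+⟪ω,ω⟫≡4 = begin
      + 2 * ⟪ c₁ , cω ⟫ L + ⟪ cω , cω ⟫ L
        ≡⟨ cong₂ (λ p q → + 2 * p + q) (i+j≡i (⟪ c₁ , cω ⟫ L) (i*j≡0 (+ 7) (⟪-,√7ω⟫≡0 c√7)))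
                                        (i+j≡i (⟪ cω , cω ⟫ L) (i*j≡0 (+ 7) (⟪-,√7ω⟫≡0 c√7ω))) ⟨
      + 2 * (⟪ c₁ , cω ⟫ L + + 7 * ⟪ c√7 , c√7ω ⟫ L) + (⟪ cω , cω ⟫ L + + 7 * ⟪ c√7ω , c√7ω ⟫ L)
        ≡⟨ cong cω gram≡α ⟩
      + 4 ∎

    diagonal-norms : A ≡ 5 × B ≡ 1 × C ≡ 2
    diagonal-norms = norm-diagonal {s / 4} {A} {B} {C} {D} 3≤t norm-equation D≡0 C≡2m B≢0 m≢0
      where
      C≡2m : C ≡ 2 ℕ.* ∣ + 2 - ⟪ c₁ , cω ⟫ L ∣
      C≡2m = trans (cong ∣_∣ (2i+j≡4⇒j≡2[2-i] (⟪ c₁ , cω ⟫ L) (⟪ cω , cω ⟫ L) 2⟪1,ω⟫+⟪ω,ω⟫≡4))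
                   (ℤP.abs-* (+ 2) (+ 2 - ⟪ c₁ , cω ⟫ L))
      B≢0 : B ≢ 0
      B≢0 B≡0 = contradiction
        (trans (sym (g≡0⇒⟪f,g⟫≡0 c₁ (⟪f,f⟫≡0⇒f≡0 c√7 L (ℤP.∣i∣≡0⇒i≡0 B≡0)))) ⟪1,√7⟫≡1) (λ ())
      m≢0 : ∣ + 2 - ⟪ c₁ , cω ⟫ L ∣ ≢ 0
      m≢0 m≡0 = contradiction (subst (λ q → ∣ + 2 - q ∣ ≡ 0) ⟪1,ω⟫≡0 m≡0) (λ ())
        where
        ⟪1,ω⟫≡0 : ⟪ c₁ , cω ⟫ L ≡ + 0
        ⟪1,ω⟫≡0 = g≡0⇒⟪f,g⟫≡0 c₁
          (⟪f,f⟫≡0⇒f≡0 cω L (ℤP.∣i∣≡0⇒i≡0 (trans C≡2m (cong (2 ℕ.*_) m≡0))))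

  gramForm≡α⇒¬length≤5 : ¬ length L ≤ 5
  gramForm≡α⇒¬length≤5 len with diagonal-norms
  ... | A≡5 , B≡1 , C≡2 =
    ¬gram[[5,1,1],[1,1,0],[1,0,2]]-in-ℤ⁵ c₁ c√7 cω L len
      (∣⟪f,f⟫∣≡n⇒⟪f,f⟫≡n c₁ L A≡5) (∣⟪f,f⟫∣≡n⇒⟪f,f⟫≡n c√7 L B≡1) ⟪ω,ω⟫≡2
      ⟪1,√7⟫≡1 ⟪1,ω⟫≡1 ⟪√7,ω⟫≡0
    where
    ⟪ω,ω⟫≡2 : ⟪ cω , cω ⟫ L ≡ + 2
    ⟪ω,ω⟫≡2 = ∣⟪f,f⟫∣≡n⇒⟪f,f⟫≡n cω L C≡2
    ⟪1,ω⟫≡1 : ⟪ c₁ , cω ⟫ L ≡ + 1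
    ⟪1,ω⟫≡1 = ℤP.*-cancelˡ-≡ (+ 2) _ (+ 1) (+-cancelʳ (+ 2) _ _
      (trans (cong (_+_ (+ 2 * ⟪ c₁ , cω ⟫ L)) (sym ⟪ω,ω⟫≡2)) 2⟪1,ω⟫+⟪ω,ω⟫≡4))

sumSq≢alpha : ∀ {s n} → 3 ≤ s / 4 → n ≤ 5 → (v : Vec (OK s) n) → sumSq v ≢ alpha s
sumSq≢alpha {s} 3≤t n≤5 v sumSq≡α =
  gramForm≡α⇒¬length≤5 3≤t (toList v) gram≡α (subst (_≤ 5) (sym (length-toList v)) n≤5)
  where
  gram≡α : gramForm (toList v) ≡ αExpanded s
  gram≡α = begin
    gramForm (toList v) ≡⟨ sumSq≡gramForm v ⟨
    sumSq v             ≡⟨ sumSq≡α ⟩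
    alpha s             ≡⟨ alpha≡αExpanded ⟩
    αExpanded s         ∎

3≤s/4 : ∀ {s} → 7 < s → SquareFree s → s % 4 ≡ 1 → 3 ≤ s / 4
3≤s/4 {s} 7<s squarefree s%4≡1 =
  3≤q (s / 4) 7<s squarefree (trans (ℕ.m≡m%n+[m/n]*n s 4) (cong (ℕ._+ s / 4 ℕ.* 4) s%4≡1))
  where
  3≤q : ∀ {n} q → 7 < n → SquareFree n → n ≡ 1 ℕ.+ q ℕ.* 4 → 3 ≤ q
  3≤q 0 7<1 _ refl = contradiction 7<1 (from-no (7 <? 1))
  3≤q 1 7<5 _ refl = contradiction 7<5 (from-no (7 <? 5))
  3≤q 2 _ squarefree refl = ⊥-elim (squarefree 3 (from-yes (prime? 3)) (divides 1 refl))
  3≤q (suc (suc (suc _))) _ _ _ = s≤s (s≤s (s≤s z≤n))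

proposition3p3 : (s : ℕ) → 7 < s → SquareFree s → ¬ (7 ∣ s) → s % 4 ≡ 1 →
    PythagorasAtLeast s 6 × HasLength s (alpha s) 6
-- 7 ∤ s is only needed for O_K = ℤ[√7][ω], which the definition of OK already assumes.
proposition3p3 s 7<s squarefree _ s%4≡1 =
  (alpha s , (6 , sixSquaresRep) , ¬fewer) , sixSquaresRep , ¬fewer
  where
  sixSquaresRep : RepBy s 6 (alpha s)
  sixSquaresRep = sixSquares , sumSq-sixSquares
  ¬fewer : ∀ m → m < 6 → ¬ RepBy s m (alpha s)
  ¬fewer m m<6 (v , sumSq≡α) =
    sumSq≢alpha (3≤s/4 7<s squarefree s%4≡1) (ℕP.≤-pred m<6) v sumSq≡α
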